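{- Let $G$ be a graph (with at least one vertex). Then: (i) ${\rm z}(G)\le\max_{u\in V(G)}{\rm z}(G^+(u))$; (ii) if $G$ is z-monotonic, equality holds in (i); (iii) ${\rm b}^{\ast}(G)\le\max_{u\in V(G)}{\rm b}^{\ast}(G[B(u,2)])$.
   Context: Graphs are finite, simple, undirected; $d_G(u)$ is the degree of $u$, $d_G(u,v)$ the distance, $G[S]$ the induced subgraph on $S$. $B(u,r)=\{v\in V(G): d_G(u,v)\le r\}$ and $G^+(u)=G[B(u,d_G(u)+1)]$. For a proper coloring $c:V(G)\to\{1,\dots,k\}$, a vertex $u$ is a b-vertex if every color $j\in\{1,\dots,k\}\setminus\{c(u)\}$ appears on a neighbour of $u$. A Grundy-coloring with $k$ colors is a proper coloring $c:V(G)\to\{1,\dots,k\}$ using every color such that for all $i<j$ every vertex of color $j$ has a neighbour of color $i$. A z-coloring with $k$ colors is a Grundy-coloring with $k$ colors containing a b-vertex $u$ with $c(u)=k$ adjacent, for each $j<k$, to a b-vertex of color $j$; ${\rm z}(G)$ is the maximum such $k$. A ${\rm b}^{\ast}$-coloring with $k$ colors is a proper coloring $c:V(G)\to\{1,\dots,k\}$ containing a b-vertex $u$ with $c(u)=k$ adjacent, for each $j<k$, to a b-vertex of color $j$; ${\rm b}^{\ast}(G)$ is the maximum such $k$. $G$ is z-monotonic if ${\rm z}(H_2)\le{\rm z}(H_1)$ for every induced subgraph $H_1$ of $G$ and every induced subgraph $H_2$ of $H_1$. -}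

module Defs where

open import Level using (0ℓ)
open import Data.Nat using (ℕ; zero; suc; _+_; _≤_; _<_)
open import Data.Bool using (Bool; true; false; T; if_then_else_)
open import Data.Fin using (Fin)
open import Data.List using (List; map; allFin)
open import Data.Nat.ListAction using (sum)
open import Data.Product using (Σ; ∃; _×_; _,_)
open import Relation.Binary.PropositionalEquality using (_≡_; _≢_)
open import Relation.Unary using (Pred; _∈_; _⊆_)

record Graph : Set where
  field
    n     : ℕ
    E     : Fin n → Fin n → Bool
    sym   : ∀ u v → E u v ≡ E v u
    irrefl : ∀ u → E u u ≡ false

open Graph public

Adj : (G : Graph) → Fin (n G) → Fin (n G) → Set
Adj G u v = T (E G u v)

-- vertex subsets (inducing subgraphs G[S])
VSet : Graph → Set₁
VSet G = Pred (Fin (n G)) 0ℓ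

Full : (G : Graph) → VSet G
Full G _ = Data.Unit.⊤
  where import Data.Unit

deg : (G : Graph) → Fin (n G) → ℕ
deg G u = sum (map (λ v → if E G u v then 1 else 0) (allFin (n G)))

data Reach (G : Graph) : ℕ → Fin (n G) → Fin (n G) → Set where
  here : ∀ {r u} → Reach G r u u
  step : ∀ {r u w v} → Adj G u w → Reach G r w v → Reach G (suc r) u v

Ball : (G : Graph) → Fin (n G) → ℕ → VSet G
Ball G u r v = Reach G r u v

Plus : (G : Graph) → Fin (n G) → VSet G
Plus G u = Ball G u (deg G u + 1)

-- Colorings of the induced subgraph G[S] are maps c : Fin n → ℕ, only the
-- values on S matter; colors are 1,…,k.
Coloring : Graph → Set
Coloring G = Fin (n G) → ℕ

Proper : (G : Graph) → VSet G → ℕ → Coloring G → Set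
Proper G S k c =
  (∀ v → v ∈ S → 1 ≤ c v × c v ≤ k) ×
  (∀ u v → u ∈ S → v ∈ S → Adj G u v → c u ≢ c v)

UsesAll : (G : Graph) → VSet G → ℕ → Coloring G → Set
UsesAll G S k c = ∀ j → 1 ≤ j → j ≤ k → ∃ λ v → v ∈ S × c v ≡ j

IsBVertex : (G : Graph) → VSet G → ℕ → Coloring G → Fin (n G) → Set
IsBVertex G S k c u =
  ∀ j → 1 ≤ j → j ≤ k → j ≢ c u → ∃ λ v → v ∈ S × Adj G u v × c v ≡ j

Grundy : (G : Graph) → VSet G → ℕ → Coloring G → Set
Grundy G S k c =
  Proper G S k c × UsesAll G S k c ×
  (∀ v → v ∈ S → ∀ i → 1 ≤ i → i < c v → ∃ λ w → w ∈ S × Adj G v w × c w ≡ i)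

HasBStarCenter : (G : Graph) → VSet G → ℕ → Coloring G → Set
HasBStarCenter G S k c =
  ∃ λ u → u ∈ S × c u ≡ k × IsBVertex G S k c u ×
    (∀ j → 1 ≤ j → j < k →
       ∃ λ w → w ∈ S × Adj G u w × c w ≡ j × IsBVertex G S k c w)

ZColorable : (G : Graph) → VSet G → ℕ → Set
ZColorable G S k = ∃ λ c → Grundy G S k c × HasBStarCenter G S k c

BStarColorable : (G : Graph) → VSet G → ℕ → Set
BStarColorable G S k = ∃ λ c → Proper G S k c × HasBStarCenter G S k c

-- z(G[S₂]) ≤ z(G[S₁]) expressed via the colorability predicates:
-- every k achieved on G[S₂] is bounded by some k' achieved on G[S₁]
ZLe : (G : Graph) → VSet G → VSet G → Set
ZLe G S₂ S₁ = ∀ k → ZColorable G S₂ k → ∃ λ k' → k ≤ k' × ZColorable G S₁ k'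

BStarLe : (G : Graph) → VSet G → VSet G → Set
BStarLe G S₂ S₁ = ∀ k → BStarColorable G S₂ k → ∃ λ k' → k ≤ k' × BStarColorable G S₁ k'

ZMonotonic : Graph → Set₁
ZMonotonic G = ∀ (S₁ S₂ : VSet G) → S₂ ⊆ S₁ → ZLe G S₂ S₁

-- For (i), let c be a z-coloring with k colors and b*-center u.  As u sees k − 1
-- colors, d(u) ≥ k − 1.  Recolor G⁺(u) by first fit, taking the vertices in increasing
-- order of c: this gives a Grundy coloring with colors ≤ c, which agrees with c on every
-- vertex v reached from u by a walk of length r with r + c(v) ≤ k + 1.  These vertices
-- lie in B(u,k) ⊆ G⁺(u) and include u, its neighbours of color < k and theirs, so u
-- stays a b*-center.  (iii) is the same observation without recoloring, as a b*-center
-- only involves B(u,2); (ii) is z-monotonicity applied to G⁺(u) ⊆ V(G).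
{-# OPTIONS --safe #-}
module Submission where

open import Defs
open import Data.Nat using (ℕ; _≤_; _+_)
open import Data.Fin using (Fin)
open import Data.Product using (Σ; ∃; _×_; _,_)

open import Level using (0ℓ)
open import Function using (_∘_; flip)
open import Data.Nat using (zero; suc; _<_; _≤?_; _<?_; z≤n; s≤s)
import Data.Nat as ℕ
open import Data.Nat.Properties
open import Data.Nat.Induction using (<-wellFounded)
open import Data.Nat.ListAction using (sum)
open import Data.Fin.Properties using (any?) renaming (_≟_ to _≟ᶠ_)
open import Data.Bool using (T; if_then_else_)
open import Data.Unit using (tt)
open import Data.Sum using (inj₁; inj₂)
open import Data.Product using (proj₁; proj₂; map₂)
open import Data.List using (List; []; _∷_; map; filter; allFin)
open import Data.List.Properties using (map-cong-local)
open import Data.List.Extrema.Nat using (max; xs≤max)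
import Data.List.Relation.Unary.All as All
open import Data.List.Relation.Unary.Any using (here; there)
open import Data.List.Membership.Propositional using (_∈_; _∉_)
open import Data.List.Membership.Propositional.Properties
  using (∈-map⁺; ∈-map⁻; ∈-filter⁺; ∈-filter⁻; ∈-allFin)
open import Data.List.Membership.DecPropositional ℕ._≟_ using (_∈?_)
import Induction.WellFounded as WF
import Relation.Binary.Construct.On as On
open import Relation.Binary.Definitions using (tri<; tri≈; tri>)
open import Relation.Binary.PropositionalEquality as ≡
  using (_≡_; _≢_; refl; trans; cong; subst)
open import Relation.Nullary using (¬_; Dec; does; yes; no; contradiction)
open import Relation.Nullary.Decidable using (_×-dec_)
open import Relation.Nullary.Decidable.Core using (T?)
open import Relation.Unary using (Pred; Decidable; _⊆_)

-- The least positive integer not in L (colors start at 1).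
module _ (L : List ℕ) where
  private
    search : ℕ → ℕ → ℕ
    search zero    i = i
    search (suc f) i with i ∈? L
    ... | yes _ = search f (suc i)
    ... | no  _ = i

    search-∉ : ∀ f i → max 0 L < i + f → search f i ∉ L
    search-∉ zero    i lt i∈L =
      <⇒≱ (subst (max 0 L <_) (+-identityʳ i) lt) (All.lookup (xs≤max 0 L) i∈L)
    search-∉ (suc f) i lt with i ∈? L
    ... | yes _   = search-∉ f (suc i) (subst (max 0 L <_) (+-suc i f) lt)
    ... | no  i∉L = i∉L

    search-≥ : ∀ f i → i ≤ search f i
    search-≥ zero    i = ≤-refl
    search-≥ (suc f) i with i ∈? L
    ... | yes _ = ≤-trans (n≤1+n i) (search-≥ f (suc i))
    ... | no  _ = ≤-refl

    search-below : ∀ f i j → i ≤ j → j < search f i → j ∈ L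
    search-below zero    i j i≤j j<i = contradiction i≤j (<⇒≱ j<i)
    search-below (suc f) i j i≤j j<s with i ∈? L
    ... | no  _ = contradiction i≤j (<⇒≱ j<s)
    ... | yes i∈L with m≤n⇒m<n∨m≡n i≤j
    ...   | inj₁ i<j  = search-below f (suc i) j i<j j<s
    ...   | inj₂ refl = i∈L

  mex : ℕ
  mex = search (suc (max 0 L)) 1

  mex-∉ : mex ∉ L
  mex-∉ = search-∉ (suc (max 0 L)) 1 (n≤1+n (suc (max 0 L)))

  mex-pos : 1 ≤ mex
  mex-pos = search-≥ (suc (max 0 L)) 1

  mex-below : ∀ {i} → 1 ≤ i → i < mex → i ∈ L
  mex-below = search-below (suc (max 0 L)) 1 _

indicator : {A : Set} → Dec A → ℕ
indicator A? = if does A? then 1 else 0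

count : {A : Set} {P : Pred A 0ℓ} → Decidable P → List A → ℕ
count P? xs = sum (map (indicator ∘ P?) xs)

module _ {A : Set} {P Q : Pred A 0ℓ} (P? : Decidable P) (Q? : Decidable Q) (P⊆Q : P ⊆ Q) where

  private
    indicator-mono : ∀ x → indicator (P? x) ≤ indicator (Q? x)
    indicator-mono x with P? x | Q? x
    ... | no  _  | _      = z≤n
    ... | yes _  | yes _  = ≤-refl
    ... | yes px | no ¬qx = contradiction (P⊆Q px) ¬qx

    indicator-strict : ∀ {x} → ¬ P x → Q x → indicator (P? x) < indicator (Q? x)
    indicator-strict {x} ¬px qx with P? x | Q? x
    ... | no  _  | yes _  = ≤-refl
    ... | yes px | _      = contradiction px ¬px
    ... | no  _  | no ¬qx = contradiction qx ¬qx

  count-mono : ∀ xs → count P? xs ≤ count Q? xs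
  count-mono []       = z≤n
  count-mono (x ∷ xs) = +-mono-≤ (indicator-mono x) (count-mono xs)

  count-strict : ∀ {x} xs → x ∈ xs → ¬ P x → Q x → count P? xs < count Q? xs
  count-strict (_ ∷ xs) (here refl)  ¬px qx = +-mono-<-≤ (indicator-strict ¬px qx) (count-mono xs)
  count-strict (y ∷ xs) (there x∈xs) ¬px qx =
    +-mono-≤-< (indicator-mono y) (count-strict xs x∈xs ¬px qx)

module _ (G : Graph) where

  adj-sym : ∀ {u v} → Adj G u v → Adj G v u
  adj-sym {u} {v} = subst T (Graph.sym G u v)

  reach? : ∀ r u v → Dec (Reach G r u v)
  reach? r u v with u ≟ᶠ v
  reach? r       u v | yes refl = yes here
  reach? zero    u v | no u≢v   = no λ { here → u≢v refl }
  reach? (suc r) u v | no u≢v with any? (λ w → T? (E G u w) ×-dec reach? r w v)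
  ... | yes (w , uw , wv) = yes (step uw wv)
  ... | no  ∄w            = no λ { here → u≢v refl ; (step uw wv) → ∄w (_ , uw , wv) }

  reach-mono : ∀ {r r′ u v} → r ≤ r′ → Reach G r u v → Reach G r′ u v
  reach-mono _          here         = here
  reach-mono (s≤s r≤r′) (step uw wv) = step uw (reach-mono r≤r′ wv)

  reach-snoc : ∀ {r u v w} → Reach G r u v → Adj G v w → Reach G (suc r) u w
  reach-snoc here         vw = step vw here
  reach-snoc (step ux xv) vw = step ux (reach-snoc xv vw)

  seen-colors≤deg : ∀ u (c : Coloring G) m →
    (∀ j → 1 ≤ j → j ≤ m → ∃ λ v → Adj G u v × c v ≡ j) → m ≤ deg G u
  seen-colors≤deg u c m seen =
    ≤-trans (count-seen m seen) (count-mono (seenUpTo? m) (T? ∘ E G u) proj₁ (allFin (n G)))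
    where
    seenUpTo? : ∀ m → Decidable (λ v → Adj G u v × c v ≤ m)
    seenUpTo? m v = T? (E G u v) ×-dec c v ≤? m

    count-seen : ∀ m → (∀ j → 1 ≤ j → j ≤ m → ∃ λ v → Adj G u v × c v ≡ j) →
      m ≤ count (seenUpTo? m) (allFin (n G))
    count-seen zero    _    = z≤n
    count-seen (suc m) seen with seen (suc m) (s≤s z≤n) ≤-refl
    ... | v , uv , cv≡1+m =
      ≤-<-trans (count-seen m λ j 1≤j j≤m → seen j 1≤j (m≤n⇒m≤1+n j≤m))
        (count-strict (seenUpTo? m) (seenUpTo? (suc m)) (map₂ m≤n⇒m≤1+n)
          (allFin (n G)) (∈-allFin v)
          (<⇒≱ (≤-reflexive (≡.sym cv≡1+m)) ∘ proj₂) (uv , ≤-reflexive cv≡1+m))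

GrundyProperty : (G : Graph) → VSet G → Coloring G → Set
GrundyProperty G S c =
  ∀ v → S v → ∀ i → 1 ≤ i → i < c v → ∃ λ w → S w × Adj G v w × c w ≡ i

-- `round m` iterates the first-fit rule; it is final on vertices with c v ≤ m,
-- so `round (suc K)` is a fixed point of the rule.
module FirstFit (G : Graph) {S : VSet G} (S? : Decidable S) (c : Coloring G) (K : ℕ)
                (c-pos : ∀ v → 1 ≤ c v) (c≤K : ∀ v → c v ≤ K) where

  Earlier : Fin (n G) → VSet G
  Earlier v y = Adj G v y × S y × c y < c v

  earlier : Fin (n G) → List (Fin (n G))
  earlier v = filter (λ y → T? (E G v y) ×-dec S? y ×-dec c y <? c v) (allFin (n G))

  earlier⁺ : ∀ {v y} → Earlier v y → y ∈ earlier v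
  earlier⁺ {y = y} = ∈-filter⁺ _ (∈-allFin y)

  earlier⁻ : ∀ {v y} → y ∈ earlier v → Earlier v y
  earlier⁻ = proj₂ ∘ ∈-filter⁻ _ {xs = allFin (n G)}

  round : ℕ → Coloring G
  round zero    _ = 1
  round (suc m) v = mex (map (round m) (earlier v))

  round-stable : ∀ m v → c v ≤ m → round m v ≡ round (suc m) v
  round-stable zero    v cv≤0   = contradiction cv≤0 (<⇒≱ (c-pos v))
  round-stable (suc m) v cv≤1+m = cong mex (map-cong-local (All.tabulate λ y∈ →
    let (_ , _ , cy<cv) = earlier⁻ y∈ in
    round-stable m _ (m<1+n⇒m≤n (<-≤-trans cy<cv cv≤1+m))))

  ff : Coloring G
  ff = round (suc K)

  ff-mex : ∀ v → ff v ≡ mex (map ff (earlier v))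
  ff-mex v = cong mex (map-cong-local {xs = earlier v} (All.tabulate λ {y} _ →
    round-stable K y (c≤K y)))

  ff-avoids : ∀ {v y} → Earlier v y → ff y ≢ ff v
  ff-avoids {v} vy ffy≡ffv = mex-∉ (map ff (earlier v))
    (subst (_∈ map ff (earlier v)) (trans ffy≡ffv (ff-mex v)) (∈-map⁺ ff (earlier⁺ vy)))

  ff-below : ∀ {v i} → 1 ≤ i → i < ff v → ∃ λ y → Earlier v y × ff y ≡ i
  ff-below {v} 1≤i i<ffv
    with ∈-map⁻ ff (mex-below (map ff (earlier v)) 1≤i (subst (_ <_) (ff-mex v) i<ffv))
  ... | y , y∈ , i≡ffy = y , earlier⁻ y∈ , ≡.sym i≡ffy

  ff-pos : ∀ v → 1 ≤ ff v
  ff-pos v = subst (1 ≤_) (≡.sym (ff-mex v)) (mex-pos (map ff (earlier v)))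

  ff-grundy : GrundyProperty G S ff
  ff-grundy v _ i 1≤i i<ffv with ff-below 1≤i i<ffv
  ... | y , (vy , Sy , _) , ffy≡i = y , Sy , vy , ffy≡i

  ff-proper : (∀ x y → S x → S y → Adj G x y → c x ≢ c y) →
    ∀ x y → S x → S y → Adj G x y → ff x ≢ ff y
  ff-proper c-proper x y Sx Sy xy with <-cmp (c x) (c y)
  ... | tri< cx<cy _ _ = ff-avoids (adj-sym G xy , Sx , cx<cy)
  ... | tri≈ _ cx≡cy _ = contradiction cx≡cy (c-proper x y Sx Sy xy)
  ... | tri> _ _ cy<cx = ff-avoids (xy , Sy , cy<cx) ∘ ≡.sym

  open WF.All (On.wellFounded c <-wellFounded) 0ℓ using (wfRec)

  ff≤c : ∀ v → ff v ≤ c v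
  ff≤c = wfRec (λ v → ff v ≤ c v) λ v ih → ≮⇒≥ λ cv<ffv →
    let (y , (_ , _ , cy<cv) , ffy≡cv) = ff-below (c-pos v) cv<ffv in
    <⇒≱ cy<cv (subst (_≤ c y) ffy≡cv (ih cy<cv))

  ff-agrees : ∀ {D : VSet G} → D ⊆ S → GrundyProperty G D c → ∀ {v} → D v → ff v ≡ c v
  ff-agrees {D} D⊆S D-grundy {v} = wfRec (λ v → D v → ff v ≡ c v) agrees-at v
    where
    agrees-at : ∀ v → (∀ {y} → c y < c v → D y → ff y ≡ c y) → D v → ff v ≡ c v
    agrees-at v ih Dv = ≤-antisym (ff≤c v) (≮⇒≥ λ ffv<cv →
      let (y , Dy , vy , cy≡ffv) = D-grundy v Dv (ff v) (ff-pos v) ffv<cv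
          cy<cv = subst (_< c v) (≡.sym cy≡ffv) ffv<cv in
      ff-avoids (vy , D⊆S Dy , cy<cv) (trans (ih cy<cv Dy) cy≡ffv))

IsBStarCenter : (G : Graph) → VSet G → ℕ → Coloring G → Fin (n G) → Set
IsBStarCenter G S k c u = S u × c u ≡ k × IsBVertex G S k c u ×
  (∀ j → 1 ≤ j → j < k → ∃ λ w → S w × Adj G u w × c w ≡ j × IsBVertex G S k c w)

bStarCenter⇒usesAll : ∀ {G S k c u} → IsBStarCenter G S k c u → UsesAll G S k c
bStarCenter⇒usesAll {k = k} {u = u} (Su , cu≡k , u-b , _) j 1≤j j≤k with j ℕ.≟ k
... | yes refl = u , Su , cu≡k
... | no  j≢k  =
  let (v , Sv , _ , cv≡j) = u-b j 1≤j j≤k (j≢k ∘ flip trans cu≡k) in v , Sv , cv≡j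

bVertex⇒deg : ∀ {G S k c u} → IsBVertex G S k c u → c u ≡ k → k ≤ deg G u + 1
bVertex⇒deg {k = zero} _ _ = z≤n
bVertex⇒deg {G} {k = suc k} {c} {u} u-b cu≡1+k =
  subst (suc k ≤_) (+-comm 1 (deg G u)) (s≤s (seen-colors≤deg G u c k λ j 1≤j j≤k →
    let j≢cu = <⇒≢ (s≤s j≤k) ∘ flip trans cu≡1+k
        (v , _ , uv , cv≡j) = u-b j 1≤j (m≤n⇒m≤1+n j≤k) j≢cu in
    v , uv , cv≡j))

proper-⊆ : ∀ {G S S′ k c} → S′ ⊆ S → Proper G S k c → Proper G S′ k c
proper-⊆ S′⊆S (range , proper) =
  (λ v → range v ∘ S′⊆S) , λ x y S′x S′y → proper x y (S′⊆S S′x) (S′⊆S S′y)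

-- A b-vertex adjacent to u can use u itself as its neighbour of color k, so only the
-- vertices of B(u,2) of color < k have to be kept.
module _ {G : Graph} {S S′ : VSet G} {k : ℕ} {c c′ : Coloring G} {u : Fin (n G)}
         (S′u : S′ u) (c′u≡k : c′ u ≡ k)
         (keep : ∀ {v} → Ball G u 2 v → c v < k → S′ v × c′ v ≡ c v) where

  private
    isBVertex-near : ∀ {v} → Ball G u 1 v → c′ v ≡ c v →
      IsBVertex G S k c v → IsBVertex G S′ k c′ v
    isBVertex-near {v} uv c′v≡cv v-b j 1≤j j≤k j≢c′v with m≤n⇒m<n∨m≡n j≤k
    ... | inj₁ j<k =
      let (x , _ , vx , cx≡j) = v-b j 1≤j j≤k (j≢c′v ∘ flip trans (≡.sym c′v≡cv))
          (S′x , c′x≡cx) = keep (reach-snoc G uv vx) (subst (_< k) (≡.sym cx≡j) j<k) in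
      x , S′x , vx , trans c′x≡cx cx≡j
    isBVertex-near here           _ _ _ _ _ j≢c′u | inj₂ refl =
      contradiction (≡.sym c′u≡k) j≢c′u
    isBVertex-near (step uv here) _ _ _ _ _ _     | inj₂ refl =
      u , S′u , adj-sym G uv , c′u≡k

  isBStarCenter-local : IsBStarCenter G S k c u → IsBStarCenter G S′ k c′ u
  isBStarCenter-local (_ , cu≡k , u-b , u-nbrs) =
    S′u , c′u≡k , isBVertex-near here (trans c′u≡k (≡.sym cu≡k)) u-b , nbrs
    where
    nbrs : ∀ j → 1 ≤ j → j < k →
      ∃ λ w → S′ w × Adj G u w × c′ w ≡ j × IsBVertex G S′ k c′ w
    nbrs j 1≤j j<k with u-nbrs j 1≤j j<k
    ... | w , _ , uw , cw≡j , w-b =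
      let (S′w , c′w≡cw) = keep (step uw here) (subst (_< k) (≡.sym cw≡j) j<k) in
      w , S′w , uw , trans c′w≡cw cw≡j , isBVertex-near (step uw here) c′w≡cw w-b

-- A step to a Grundy witness lowers the color by at least one, so the cone is closed
-- under Grundy witnesses while staying inside B(u,k).
Cone : (G : Graph) → Coloring G → Fin (n G) → ℕ → VSet G
Cone G c u k v = ∃ λ r → Reach G r u v × r + c v ≤ suc k

module ConeProperties (G : Graph) (c : Coloring G) (u : Fin (n G)) (k : ℕ) where

  cone-center : c u ≡ k → Cone G c u k u
  cone-center cu≡k = 0 , here , subst (_≤ suc k) (≡.sym cu≡k) (n≤1+n k)

  cone-ball₂ : ∀ {v} → Ball G u 2 v → c v < k → Cone G c u k v
  cone-ball₂ u2v cv<k = 2 , u2v , s≤s cv<k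

  cone⊆ball : (∀ v → 1 ≤ c v) → Cone G c u k ⊆ Ball G u k
  cone⊆ball c-pos {v} (r , uv , r+cv≤1+k) = reach-mono G r≤k uv
    where
    r≤k : r ≤ k
    r≤k = ≤-pred (≤-trans (subst (_≤ r + c v) (+-comm r 1) (+-monoʳ-≤ r (c-pos v))) r+cv≤1+k)

  cone-grundy : GrundyProperty G (Full G) c → GrundyProperty G (Cone G c u k) c
  cone-grundy c-grundy v (r , uv , r+cv≤1+k) i 1≤i i<cv with c-grundy v tt i 1≤i i<cv
  ... | w , _ , vw , cw≡i =
    w , (suc r , reach-snoc G uv vw , ≤-trans (+-monoʳ-< r cw<cv) r+cv≤1+k) , vw , cw≡i
    where
    cw<cv : c w < c v
    cw<cv = subst (_< c v) (≡.sym cw≡i) i<cv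

zColorable⇒plus : ∀ G k → ZColorable G (Full G) k → ∃ λ u → ZColorable G (Plus G u) k
zColorable⇒plus G k (c , (c-proper , _ , c-grundy) , u , center@(_ , cu≡k , u-b , _)) =
  u , ff , (ff-proper′ , bStarCenter⇒usesAll {G = G} {c = ff} center′ , ff-grundy) , u , center′
  where
  c-pos : ∀ v → 1 ≤ c v
  c-pos v = proj₁ (proj₁ c-proper v tt)

  c≤k : ∀ v → c v ≤ k
  c≤k v = proj₂ (proj₁ c-proper v tt)

  open FirstFit G (reach? G (deg G u + 1) u) c k c-pos c≤k
  open ConeProperties G c u k

  cone⊆plus : Cone G c u k ⊆ Plus G u
  cone⊆plus = reach-mono G (bVertex⇒deg {G = G} {c = c} u-b cu≡k) ∘ cone⊆ball c-pos

  ff≡c : ∀ {v} → Cone G c u k v → ff v ≡ c v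
  ff≡c = ff-agrees cone⊆plus (cone-grundy c-grundy)

  center′ : IsBStarCenter G (Plus G u) k ff u
  center′ = isBStarCenter-local {G = G} {c = c} {c′ = ff}
    (cone⊆plus (cone-center cu≡k)) (trans (ff≡c (cone-center cu≡k)) cu≡k)
    (λ u2v cv<k → cone⊆plus (cone-ball₂ u2v cv<k) , ff≡c (cone-ball₂ u2v cv<k)) center

  ff-proper′ : Proper G (Plus G u) k ff
  ff-proper′ = (λ v _ → ff-pos v , ≤-trans (ff≤c v) (c≤k v)) ,
               ff-proper (λ x y _ _ → proj₂ c-proper x y tt tt)

bStarColorable⇒ball₂ : ∀ G k → BStarColorable G (Full G) k →
  ∃ λ u → BStarColorable G (Ball G u 2) k
bStarColorable⇒ball₂ G k (c , c-proper , u , center@(_ , cu≡k , _)) =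
  u , c , proper-⊆ {G = G} (λ _ → tt) c-proper ,
  u , isBStarCenter-local {G = G} {c = c} {c′ = c} here cu≡k (λ u2v _ → u2v , refl) center

proposition9 : (G : Graph) → 1 ≤ n G →
    -- (i) z(G) ≤ max_u z(G⁺(u))
    (∀ k → ZColorable G (Full G) k →
       ∃ λ u → ∃ λ k' → k ≤ k' × ZColorable G (Plus G u) k')
    -- (ii) if G is z-monotonic, also max_u z(G⁺(u)) ≤ z(G)
    × (ZMonotonic G → ∀ u → ZLe G (Plus G u) (Full G))
    -- (iii) b*(G) ≤ max_u b*(G[B(u,2)])
    × (∀ k → BStarColorable G (Full G) k →
       ∃ λ u → ∃ λ k' → k ≤ k' × BStarColorable G (Ball G u 2) k')
proposition9 G _ =
  (λ k z → let (u , z′) = zColorable⇒plus G k z in u , k , ≤-refl , z′) ,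
  (λ mono u → mono (Full G) (Plus G u) (λ _ → tt)) ,
  (λ k b → let (u , b′) = bStarColorable⇒ball₂ G k b in u , k , ≤-refl , b′)
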